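{- Let $I$ be a $Q$-interval of $\mathcal{P}$ with domain $D(I)=\{x_1,x_2,\ldots,x_r\}$, listed in the order of the $Q$-node (so $\max(\mathrm{Int}(x_i))+1=\min(\mathrm{Int}(x_{i+1}))$). Then $I$ is a $b$-nested common interval if and only if either $\mathrm{Int}(x_1)$ is $b$-small and $I\setminus \mathrm{Int}(x_1)$ is a $b$-nested common interval, or $\mathrm{Int}(x_r)$ is $b$-small and $I\setminus\mathrm{Int}(x_r)$ is a $b$-nested common interval.
   Context: Let $n,K\geq 1$ and let $\mathcal{P}=\{P_1,\ldots,P_K\}$ be a set of permutations of $\{1,\ldots,n\}$ with $P_1=\mathrm{Id}_n$. For $i\le j$, $(i..j)=\{i,\ldots,j\}$. A common interval of $\mathcal{P}$ is a set of integers occupying consecutive positions in every $P_k$; every common interval has the form $(i..j)$. Fix a positive integer $b$. A common interval $I$ is $b$-nested if $|I|=1$ or $I$ strictly contains a $b$-nested common interval $J$ with $|J|\geq|I|-b$; it is $b$-small if $|I|\le b$ and $b$-large otherwise. Two intervals $(i..j)$, $(k..l)$ overlap if $i<k\le j<l$ or $k<i\le l<j$. A common interval is strong if it overlaps no other common interval. Let $T$ be the inclusion tree of strong common intervals (nodes $x$ correspond bijectively to strong common intervals $\mathrm{Int}(x)$, root $(1..n)$, $x$ parent of $y$ iff $\mathrm{Int}(x)$ is the smallest strong common interval strictly containing $\mathrm{Int}(y)$). A node $x$ with children set $D$ is labeled $P$ if for every $D'\subset D$ with $2\le|D'|<|D|$ the union of $\mathrm{Int}(z)$, $z\in D'$,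 is not a common interval; otherwise $Q$. The children of a $Q$-node are ordered $y_1,\ldots,y_r$ with $\max(\mathrm{Int}(y_i))+1=\min(\mathrm{Int}(y_{i+1}))$. It is known that every common interval $I$ is either strong or equals $\bigcup_{h=l}^m\mathrm{Int}(z_h)$ for consecutive children $z_l,\ldots,z_m$ of a unique $Q$-node. The domain $D(I)$ is the set of children of the node of $I$ if $I$ is strong, and $\{z_l,\ldots,z_m\}$ otherwise. A $P$-interval is a strong common interval whose node is labeled $P$; every other common interval is a $Q$-interval. -}

module Defs where

open import Data.Nat using (ℕ; zero; suc; _+_; _∸_; _≤_; _<_)
open import Data.Fin using (Fin; toℕ)
open import Data.Fin.Permutation using (Permutation′; _⟨$⟩ʳ_)
open import Data.Product using (_×_; _,_; proj₁; proj₂; ∃-syntax)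
open import Data.Sum using (_⊎_)
open import Data.List using (List; length)
open import Data.List.Relation.Unary.All using (All)
open import Data.List.Relation.Unary.Any using (Any)
open import Data.List.Relation.Unary.Unique.Propositional using (Unique)
open import Data.List.Membership.Propositional using (_∉_)
open import Function.Bundles using (_⇔_)
open import Relation.Nullary using (¬_)

-- Conventions: the ground set {1,…,n} is encoded as {0,…,n-1} (ℕ values < n).
-- A permutation P_k is a bijection positions → elements: (P k ⟨$⟩ʳ p) is the
-- element at position p.  The interval (i..j) (with i ≤ j) is the pair i j.

InI : ℕ → ℕ → ℕ → Set
InI i j e = i ≤ e × e ≤ j

Sub : ℕ → ℕ → ℕ → ℕ → Set
Sub k l i j = i ≤ k × l ≤ j

StrictSub : ℕ → ℕ → ℕ → ℕ → Set
StrictSub k l i j = Sub k l i j × (i < k ⊎ l < j)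

Overlap : ℕ → ℕ → ℕ → ℕ → Set
Overlap i j k l = (i < k × k ≤ j × j < l) ⊎ (k < i × i ≤ l × l < j)

Small : ℕ → ℕ → ℕ → Set
Small b k l = suc (l ∸ k) ≤ b

InUnion : List (ℕ × ℕ) → ℕ → Set
InUnion D e = Any (λ c → InI (proj₁ c) (proj₂ c) e) D

module _ {n K : ℕ} (P : Fin K → Permutation′ n) where

  Common : ℕ → ℕ → Set
  Common i j = i ≤ j × j < n ×
    ((q : Fin K) → ∃[ s ] ((p : Fin n) →
       ((s ≤ toℕ p × toℕ p ≤ s + (j ∸ i)) ⇔ InI i j (toℕ (P q ⟨$⟩ʳ p)))))

  Strong : ℕ → ℕ → Set
  Strong i j = Common i j × ((k l : ℕ) → Common k l → ¬ Overlap i j k l)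

  -- the node of (k..l) is a child of the node of (i..j) in the tree T
  Child : ℕ → ℕ → ℕ → ℕ → Set
  Child i j k l = Strong i j × Strong k l × StrictSub k l i j ×
    ((a c : ℕ) → Strong a c → StrictSub k l a c → Sub i j a c)

  -- the node of the strong interval (i..j) is labeled Q: some set D' of
  -- children with 2 ≤ |D'| < |D| has a union which is a common interval
  QNode : ℕ → ℕ → Set
  QNode i j = Strong i j × ∃[ D' ] (Unique D' × 2 ≤ length D' ×
    All (λ c → Child i j (proj₁ c) (proj₂ c)) D' ×
    (∃[ c ] (Child i j (proj₁ c) (proj₂ c) × c ∉ D')) ×
    ∃[ a ] ∃[ c ] (Common a c × ((e : ℕ) → InI a c e ⇔ InUnion D' e)))

  PInterval : ℕ → ℕ → Set
  PInterval i j = Strong i j × ¬ QNode i j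

  QInterval : ℕ → ℕ → Set
  QInterval i j = Common i j × ¬ PInterval i j

  -- (k..l) is (the interval of) an element of the domain D((i..j))
  Domain : ℕ → ℕ → ℕ → ℕ → Set
  Domain i j k l =
    (Strong i j × Child i j k l) ⊎
    (¬ Strong i j × ∃[ a ] ∃[ c ] (QNode a c × Child a c k l × Sub k l i j ×
       ((e : ℕ) → InI i j e ⇔
          (∃[ k′ ] ∃[ l′ ] (Child a c k′ l′ × Sub k′ l′ i j × InI k′ l′ e)))))

  module _ (b : ℕ) where

    data Nested : ℕ → ℕ → Set where
      base : ∀ {i} → Common i i → Nested i i
      step : ∀ {i j k l} → Common i j → Nested k l → StrictSub k l i j →
             suc (j ∸ i) ≤ suc (l ∸ k) + b → Nested i j

    RestNested : ℕ → ℕ → ℕ → ℕ → Set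
    RestNested i j k l = ∃[ a ] ∃[ c ]
      (((e : ℕ) → InI a c e ⇔ (InI i j e × ¬ InI k l e)) × Nested a c)

-- A common interval (i..j) of P is, in each permutation, a window of consecutive positions
-- holding exactly the values i..j.  Comparing such windows shows that two overlapping common
-- intervals have common intersection, union and differences.  Consequently the union of a
-- run of adjacent children of a Q-node is common: a Q-node is covered by two overlapping
-- common intervals, and a common interval straddling the border between two adjacent
-- children can be shrunk until it is their union.  For a Q-interval I with domain x₁,…,x_r
-- this gives that I ∖ x₁ and I ∖ x_r are common.  If I is b-nested, it strictly contains a
-- b-nested J with |I| ≤ |J| + b; J cannot overlap the strong intervals x₁ and x_r, so it misses
-- one of them, which is then b-small, and the rest of I, containing J, is b-nested.
-- Conversely, removing a b-small end of I leaves a b-nested R ⊊ I with |I| ≤ |R| + b.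
-- Classical steps are carried out in the double-negation monad; what is extracted from them
-- (equalities of numbers, commonness of an interval) is decidable.

module Submission where

open import Data.Empty using (⊥-elim)
open import Data.Fin using (Fin; zero; toℕ; fromℕ<)
open import Data.Fin.Permutation using (Permutation′; _⟨$⟩ʳ_; _⟨$⟩ˡ_; inverseʳ; flip)
open import Data.Fin.Properties using (toℕ-fromℕ<; toℕ-injective; toℕ<n; injective⇒≤; all?; any?)
open import Data.List using (List; []; _∷_; _++_; [_])
open import Data.List.Membership.Propositional using (_∈_; find; lose)
open import Data.List.Membership.Propositional.Properties using (∈-++⁺ʳ)
open import Data.List.Properties using (∷-injectiveˡ; ∷-injectiveʳ)
open import Data.List.Relation.Unary.All as All using (All; []; _∷_; lookup; tabulate)
open import Data.List.Relation.Unary.All.Properties using (++⁻ˡ)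
open import Data.List.Relation.Unary.AllPairs using (_∷_)
open import Data.List.Relation.Unary.Any using (here; there)
open import Data.List.Relation.Unary.Linked using (Linked; [-]; _∷_)
open import Data.List.Relation.Unary.Unique.Propositional using (Unique)
open import Data.Nat
open import Data.Nat.Induction using (<-rec)
open import Data.Nat.Properties
open import Data.Product using (_×_; _,_; proj₁; proj₂; ∃-syntax)
open import Data.Product.Function.NonDependent.Propositional using (_×-⇔_)
open import Data.Sum using (_⊎_; inj₁; inj₂; [_,_]′; swap; map₂)
open import Data.Sum.Function.Propositional using (_⊎-⇔_)
open import Effect.Monad using (RawMonad)
open import Function.Base using (_∘_; id)
open import Function.Bundles using (_⇔_; mk⇔; Equivalence; Injection)
open import Function.Construct.Composition using (_⇔-∘_)
open import Function.Construct.Symmetry using (⇔-sym)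
open import Function.Definitions using (Injective)
open import Function.Properties.Inverse using (↔⇒↣)
open import Function.Related.TypeIsomorphisms using (¬-cong-⇔)
open import Level using (0ℓ)
open import Relation.Binary.Definitions using (tri<; tri≈; tri>)
open import Relation.Binary.PropositionalEquality
  using (_≡_; _≢_; refl; sym; trans; cong; cong₂; subst; subst₂; module ≡-Reasoning)
open import Relation.Nullary using (¬_; Dec; yes; no; contradiction)
open import Relation.Nullary.Decidable using (_×-dec_; _→-dec_; map′; decidable-stable; ¬¬-excluded-middle)
open import Relation.Nullary.Negation using (¬¬-Monad)
open import Relation.Nullary.Negation.Core using (DoubleNegation)

open import Defs

open Equivalence using (to; from)
open RawMonad (¬¬-Monad {0ℓ}) using (pure; _>>=_; _<$>_)

DN : Set → Set
DN = DoubleNegation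

DN-descent : ∀ {A G : Set} (measure : A → ℕ) (Q : A → Set) →
             (∀ x → Q x → DN (G ⊎ ∃[ y ] (Q y × measure y < measure x))) →
             ∀ x → Q x → DN G
DN-descent {A} {G} measure Q shrink x qx = <-rec Goal descend (measure x) x refl qx
  where
  Goal : ℕ → Set
  Goal m = ∀ x → measure x ≡ m → Q x → DN G
  descend : ∀ m → (∀ {k} → k < m → Goal k) → Goal m
  descend _ rec x refl qx = shrink x qx >>= [ pure , (λ (y , qy , lt) → rec lt y refl qy) ]′

-- Intervals of ℕ

staggered-∩ : ∀ {i j k l} → i ≤ k → j ≤ l → ∀ e → InI k j e ⇔ (InI i j e × InI k l e)
staggered-∩ i≤k j≤l e = mk⇔
  (λ (ke , ej) → (≤-trans i≤k ke , ej) , (ke , ≤-trans ej j≤l))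
  (λ ((_ , ej) , (ke , _)) → ke , ej)

staggered-∪ : ∀ {i j k l} → i ≤ k → k ≤ suc j → j ≤ l → ∀ e → InI i l e ⇔ (InI i j e ⊎ InI k l e)
staggered-∪ {i} {j} {k} {l} i≤k k≤1+j j≤l e = mk⇔ split
  [ (λ (ie , ej) → ie , ≤-trans ej j≤l) , (λ (ke , el) → ≤-trans i≤k ke , el) ]′
  where
  split : InI i l e → InI i j e ⊎ InI k l e
  split (ie , el) with e ≤? j
  ... | yes e≤j = inj₁ (ie , e≤j)
  ... | no  e≰j = inj₂ (≤-trans k≤1+j (≰⇒> e≰j) , el)

prefix-∖ : ∀ {i m j l} → m ≤ j → j ≤ l → ∀ e → InI i m e ⇔ (InI i j e × ¬ InI (suc m) l e)
prefix-∖ {m = m} m≤j j≤l e = mk⇔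
  (λ (ie , em) → (ie , ≤-trans em m≤j) , λ (m<e , _) → <⇒≱ m<e em)
  (λ ((ie , ej) , e∉) → ie , ≮⇒≥ (λ m<e → e∉ (m<e , ≤-trans ej j≤l)))

suffix-∖ : ∀ {i j k l} → i ≤ k → k ≤ suc j → ∀ e → InI (suc j) l e ⇔ (InI k l e × ¬ InI i j e)
suffix-∖ i≤k k≤1+j e = mk⇔
  (λ (j<e , el) → (≤-trans k≤1+j j<e , el) , λ (_ , ej) → <⇒≱ j<e ej)
  (λ ((ke , el) , e∉) → ≰⇒> (λ e≤j → e∉ (≤-trans i≤k ke , e≤j)) , el)

left-∖ : ∀ {i j k l} → i < k → k ≤ j → j ≤ l → ∀ e → InI i (pred k) e ⇔ (InI i j e × ¬ InI k l e)
left-∖ {k = suc k} _ k<j j≤l = prefix-∖ (<⇒≤ k<j) j≤l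

∩-InI : ∀ s u t v p → InI (s ⊔ t) (u ⊓ v) p ⇔ (InI s u p × InI t v p)
∩-InI s u t v p = mk⇔
  (λ (sp , pu) → (≤-trans (m≤m⊔n s t) sp , ≤-trans pu (m⊓n≤m u v)) ,
                 (≤-trans (m≤n⊔m s t) sp , ≤-trans pu (m⊓n≤n u v)))
  (λ ((sp , pu) , (tp , pv)) → ⊔-lub sp tp , ⊓-glb pu pv)

∪-InI : ∀ {s u t v c} → InI s u c → InI t v c →
        ∀ p → InI (s ⊓ t) (u ⊔ v) p ⇔ (InI s u p ⊎ InI t v p)
∪-InI {s} {u} {t} {v} {c} (sc , cu) (tc , cv) p = mk⇔ split
  [ (λ (sp , pu) → ≤-trans (m⊓n≤m s t) sp , ≤-trans pu (m≤m⊔n u v)) ,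
    (λ (tp , pv) → ≤-trans (m⊓n≤n s t) tp , ≤-trans pv (m≤n⊔m u v)) ]′
  where
  split : InI (s ⊓ t) (u ⊔ v) p → InI s u p ⊎ InI t v p
  split (lo , hi) with p ≤? c
  ... | yes p≤c = [ (λ eq → inj₁ (subst (_≤ p) eq lo , ≤-trans p≤c cu)) ,
                    (λ eq → inj₂ (subst (_≤ p) eq lo , ≤-trans p≤c cv)) ]′ (⊓-sel s t)
  ... | no  p≰c = [ (λ eq → inj₁ (≤-trans sc c≤p , subst (p ≤_) eq hi)) ,
                    (λ eq → inj₂ (≤-trans tc c≤p , subst (p ≤_) eq hi)) ]′ (⊔-sel u v)
    where
    c≤p : c ≤ p
    c≤p = <⇒≤ (≰⇒> p≰c)

∖-InI : ∀ {s u t v c a b} → InI s u c → InI t v c →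
        InI s u a → ¬ InI t v a → InI t v b → ¬ InI s u b →
        ∃[ x ] ∃[ y ] (x ≤ y × y ≤ u × (∀ p → InI x y p ⇔ (InI s u p × ¬ InI t v p)))
∖-InI {s} {u} {t} {v} {c} {a} {b} (sc , cu) (tc , cv) (sa , au) a∉B (tb , bv) b∉A with s <? t
... | yes s<t = s , pred t , <⇒≤pred s<t , ≤-trans pred[n]≤n t≤u , left-∖ s<t t≤u u≤v
  where
  t≤u : t ≤ u
  t≤u = ≤-trans tc cu
  u≤v : u ≤ v
  u≤v = ≮⇒≥ (λ v<u → b∉A (≤-trans (<⇒≤ s<t) tb , ≤-trans bv (<⇒≤ v<u)))
... | no  s≮t = suc v , u , v<u , ≤-refl , suffix-∖ t≤s (≤-trans sc (≤-trans cv (n≤1+n v)))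
  where
  t≤s : t ≤ s
  t≤s = ≮⇒≥ s≮t
  v<u : v < u
  v<u = ≰⇒> (λ u≤v → a∉B (≤-trans t≤s sa , ≤-trans au u≤v))

InI-singleton : ∀ {x y} → InI x x y ⇔ (y ≡ x)
InI-singleton = mk⇔ (λ (xy , yx) → ≤-antisym yx xy) (λ { refl → ≤-refl , ≤-refl })

InI? : ∀ i j e → Dec (InI i j e)
InI? i j e = (i ≤? e) ×-dec (e ≤? j)

laminar : ∀ {a₁ a₂ b₁ b₂ e} → ¬ Overlap a₁ a₂ b₁ b₂ → InI a₁ a₂ e → InI b₁ b₂ e →
          Sub b₁ b₂ a₁ a₂ ⊎ Sub a₁ a₂ b₁ b₂
laminar {a₁} {a₂} {b₁} {b₂} ¬ov (a₁e , ea₂) (b₁e , eb₂) with a₁ ≤? b₁ | b₂ ≤? a₂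
... | yes a₁≤b₁ | yes b₂≤a₂ = inj₁ (a₁≤b₁ , b₂≤a₂)
... | no  a₁≰b₁ | no  b₂≰a₂ = inj₂ (<⇒≤ (≰⇒> a₁≰b₁) , <⇒≤ (≰⇒> b₂≰a₂))
... | yes _     | no  b₂≰a₂ with b₁ ≤? a₁
...   | yes b₁≤a₁ = inj₂ (b₁≤a₁ , <⇒≤ (≰⇒> b₂≰a₂))
...   | no  b₁≰a₁ = contradiction (inj₁ (≰⇒> b₁≰a₁ , ≤-trans b₁e ea₂ , ≰⇒> b₂≰a₂)) ¬ov
laminar {a₁} {a₂} {b₁} {b₂} ¬ov (a₁e , ea₂) (b₁e , eb₂) | no a₁≰b₁ | yes _ with a₂ ≤? b₂
...   | yes a₂≤b₂ = inj₂ (<⇒≤ (≰⇒> a₁≰b₁) , a₂≤b₂)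
...   | no  a₂≰b₂ = contradiction (inj₂ (≰⇒> a₁≰b₁ , ≤-trans a₁e eb₂ , ≰⇒> a₂≰b₂)) ¬ov

⊆-trans : ∀ {i j k l a c} → Sub k l i j → Sub i j a c → Sub k l a c
⊆-trans (i≤k , l≤j) (a≤i , j≤c) = ≤-trans a≤i i≤k , ≤-trans l≤j j≤c

⊂-⊆-trans : ∀ {i j k l a c} → StrictSub k l i j → Sub i j a c → StrictSub k l a c
⊂-⊆-trans (kl⊆ij , i<k⊎l<j) ij⊆ac@(a≤i , j≤c) =
  ⊆-trans kl⊆ij ij⊆ac , [ inj₁ ∘ ≤-<-trans a≤i , inj₂ ∘ (λ l<j → <-≤-trans l<j j≤c) ]′ i<k⊎l<j

⊆⇒≡⊎⊂ : ∀ {i j k l} → Sub k l i j → (k ≡ i × l ≡ j) ⊎ StrictSub k l i j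
⊆⇒≡⊎⊂ {i} {j} {k} {l} kl⊆ij@(i≤k , l≤j) with i <? k | l <? j
... | yes i<k | _       = inj₂ (kl⊆ij , inj₁ i<k)
... | no  _   | yes l<j = inj₂ (kl⊆ij , inj₂ l<j)
... | no  i≮k | no  l≮j = inj₁ (≤-antisym (≮⇒≥ i≮k) i≤k , ≤-antisym l≤j (≮⇒≥ l≮j))

⊂⇒⊉ : ∀ {i j k l} → StrictSub k l i j → ¬ Sub i j k l
⊂⇒⊉ (_ , inj₁ i<k) (k≤i , _) = <⇒≱ i<k k≤i
⊂⇒⊉ (_ , inj₂ l<j) (_ , j≤l) = <⇒≱ l<j j≤l

⊆⇒size≤ : ∀ {i j k l} → Sub k l i j → l ∸ k ≤ j ∸ i
⊆⇒size≤ (i≤k , l≤j) = ∸-mono l≤j i≤k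

⊂⇒size< : ∀ {i j k l} → k ≤ l → StrictSub k l i j → l ∸ k < j ∸ i
⊂⇒size< {i} k≤l ((_ , l≤j) , inj₁ i<k) = <-≤-trans (∸-monoʳ-< i<k k≤l) (∸-monoˡ-≤ i l≤j)
⊂⇒size< {j = j} k≤l ((i≤k , _) , inj₂ l<j) = <-≤-trans (∸-monoˡ-< l<j k≤l) (∸-monoʳ-≤ j i≤k)

∸-split : ∀ {i m j} → i ≤ m → m ≤ j → j ∸ i ≡ (j ∸ m) + (m ∸ i)
∸-split {i} {m} {j} i≤m m≤j = trans (cong (_∸ i) (sym (m∸n+n≡m m≤j))) (+-∸-assoc (j ∸ m) i≤m)

disjoint-size : ∀ {i k l s t j} → i ≤ k → k ≤ l → l < s → s ≤ t → t ≤ j →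
                suc (l ∸ k) + suc (t ∸ s) ≤ suc (j ∸ i)
disjoint-size {i} {k} {l} {s} {t} {j} i≤k k≤l l<s s≤t t≤j = begin
  suc (l ∸ k) + suc (t ∸ s)  ≡⟨ +-suc (suc (l ∸ k)) (t ∸ s) ⟩
  suc (suc (l ∸ k) + (t ∸ s)) ≤⟨ s≤s (+-mono-≤ left-part (∸-monoˡ-≤ s t≤j)) ⟩
  suc ((s ∸ i) + (j ∸ s))    ≡⟨ cong suc (trans (+-comm (s ∸ i) (j ∸ s)) (sym (∸-split (≤-trans i≤k (≤-trans k≤l (<⇒≤ l<s))) (≤-trans s≤t t≤j)))) ⟩
  suc (j ∸ i)                ∎
  where
  open ≤-Reasoning
  left-part : suc (l ∸ k) ≤ s ∸ i
  left-part = ≤-trans (≤-reflexive (sym (+-∸-assoc 1 k≤l))) (∸-mono l<s i≤k)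

cover-size-from : ∀ {i j a c k l} → i ≤ j → InI a c i → (∀ e → InI i j e → InI a c e ⊎ InI k l e) →
                  suc (j ∸ i) ≤ suc (c ∸ a) + suc (l ∸ k)
cover-size-from {i} {j} {a} {c} {k} {l} i≤j (a≤i , i≤c) covered with j ≤? c
... | yes j≤c = ≤-trans (s≤s (∸-mono j≤c a≤i)) (m≤m+n _ _)
... | no  j≰c = begin
  suc (j ∸ i)                      ≡⟨ cong suc (∸-split i≤1+c c<j) ⟩
  suc ((j ∸ suc c) + (suc c ∸ i))  ≤⟨ s≤s (+-mono-≤ (∸-mono j≤l k≤1+c) (∸-monoʳ-≤ (suc c) a≤i)) ⟩
  suc ((l ∸ k) + (suc c ∸ a))      ≡⟨ cong suc (trans (+-comm (l ∸ k) _) (cong (_+ (l ∸ k)) (+-∸-assoc 1 (≤-trans a≤i i≤c)))) ⟩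
  suc (suc (c ∸ a) + (l ∸ k))      ≡⟨ sym (+-suc (suc (c ∸ a)) (l ∸ k)) ⟩
  suc (c ∸ a) + suc (l ∸ k)        ∎
  where
  open ≤-Reasoning
  c<j : c < j
  c<j = ≰⇒> j≰c
  i≤1+c : i ≤ suc c
  i≤1+c = ≤-trans i≤c (n≤1+n c)
  beyond-c : ∀ {e} → c < e → e ≤ j → InI k l e
  beyond-c c<e e≤j = [ (λ (_ , e≤c) → contradiction e≤c (<⇒≱ c<e)) , id ]′
                       (covered _ (≤-trans i≤1+c c<e , e≤j))
  k≤1+c : k ≤ suc c
  k≤1+c = proj₁ (beyond-c ≤-refl c<j)
  j≤l : j ≤ l
  j≤l = proj₂ (beyond-c c<j ≤-refl)

cover-size : ∀ {i j a c k l} → i ≤ j → (∀ e → InI i j e → InI a c e ⊎ InI k l e) →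
             suc (j ∸ i) ≤ suc (c ∸ a) + suc (l ∸ k)
cover-size {i} {j} {a} {c} {k} {l} i≤j covered with covered i (≤-refl , i≤j)
... | inj₁ i∈ac = cover-size-from i≤j i∈ac covered
... | inj₂ i∈kl = ≤-trans (cover-size-from i≤j i∈kl (λ e → swap ∘ covered e))
                          (≤-reflexive (+-comm (suc (l ∸ k)) _))

part-small : ∀ {x y m b} → x + y ≤ m → m ≤ y + b → x ≤ b
part-small {x} {y} {m} {b} fits bound = +-cancelʳ-≤ y x b (≤-trans fits (≤-trans bound (≤-reflexive (+-comm y b))))

overlap⇒⊈ : ∀ {w₁ w₂ v₁ v₂} → Overlap w₁ w₂ v₁ v₂ → ¬ Sub w₁ w₂ v₁ v₂
overlap⇒⊈ (inj₁ (w₁<v₁ , _ , _)) (v₁≤w₁ , _) = <⇒≱ w₁<v₁ v₁≤w₁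
overlap⇒⊈ (inj₂ (_ , _ , v₂<w₂)) (_ , w₂≤v₂) = <⇒≱ v₂<w₂ w₂≤v₂

overlap-point : ∀ {w₁ w₂ v₁ v₂} → Overlap w₁ w₂ v₁ v₂ → ∃[ e ] (InI w₁ w₂ e × InI v₁ v₂ e)
overlap-point (inj₁ (w₁<v₁ , v₁≤w₂ , w₂<v₂)) = _ , (<⇒≤ w₁<v₁ , v₁≤w₂) , (≤-refl , ≤-trans v₁≤w₂ (<⇒≤ w₂<v₂))
overlap-point (inj₂ (v₁<w₁ , w₁≤v₂ , v₂<w₂)) = _ , (≤-refl , ≤-trans w₁≤v₂ (<⇒≤ v₂<w₂)) , (<⇒≤ v₁<w₁ , w₁≤v₂)

Sub? : ∀ k l i j → Dec (Sub k l i j)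
Sub? k l i j = (i ≤? k) ×-dec (l ≤? j)

-- Windows of a permutation

module _ {n : ℕ} where

  injection-size-≤ : (f : Fin n → Fin n) → Injective _≡_ _≡_ f → ∀ {u v i j} → u ≤ v → v < n →
                     (∀ p → InI u v (toℕ p) → InI i j (toℕ (f p))) → v ∸ u ≤ j ∸ i
  injection-size-≤ f f-inj {u} {v} {i} {j} u≤v v<n f-maps = s≤s⁻¹ (injective⇒≤ {f = g} g-inj)
    where
    bound : (m : Fin (suc (v ∸ u))) → u + toℕ m ≤ v
    bound m = ≤-trans (+-monoʳ-≤ u (s≤s⁻¹ (toℕ<n m))) (≤-reflexive (m+[n∸m]≡n u≤v))
    pos : Fin (suc (v ∸ u)) → Fin n
    pos m = fromℕ< (≤-<-trans (bound m) v<n)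
    pos-value : ∀ m → toℕ (pos m) ≡ u + toℕ m
    pos-value m = toℕ-fromℕ< _
    image : ∀ m → InI i j (toℕ (f (pos m)))
    image m = f-maps (pos m) (subst (u ≤_) (sym (pos-value m)) (m≤m+n u _) , subst (_≤ v) (sym (pos-value m)) (bound m))
    g : Fin (suc (v ∸ u)) → Fin (suc (j ∸ i))
    g m = fromℕ< (s≤s (∸-monoˡ-≤ i (proj₂ (image m))))
    g-inj : Injective _≡_ _≡_ g
    g-inj {x} {y} gx≡gy = toℕ-injective (+-cancelˡ-≡ u _ _ (begin
      u + toℕ x      ≡⟨ sym (pos-value x) ⟩
      toℕ (pos x)    ≡⟨ cong toℕ (f-inj (toℕ-injective fx≡fy)) ⟩
      toℕ (pos y)    ≡⟨ pos-value y ⟩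
      u + toℕ y      ∎))
      where
      open ≡-Reasoning
      fx∸i≡fy∸i : toℕ (f (pos x)) ∸ i ≡ toℕ (f (pos y)) ∸ i
      fx∸i≡fy∸i = trans (sym (toℕ-fromℕ< _)) (trans (cong toℕ gx≡gy) (toℕ-fromℕ< _))
      fx≡fy : toℕ (f (pos x)) ≡ toℕ (f (pos y))
      fx≡fy = trans (sym (m∸n+n≡m (proj₁ (image x)))) (trans (cong (_+ i) fx∸i≡fy∸i) (m∸n+n≡m (proj₁ (image y))))

  module _ (π : Permutation′ n) where

    Window : ℕ → ℕ → ℕ → ℕ → Set
    Window u v i j = ∀ p → InI u v (toℕ p) ⇔ InI i j (toℕ (π ⟨$⟩ʳ p))

    Consecutive : ℕ → ℕ → Set
    Consecutive i j = ∃[ u ] ∃[ v ] (u ≤ v × v < n × Window u v i j)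

    position : ∀ {e} → e < n → Fin n
    position e<n = π ⟨$⟩ˡ fromℕ< e<n

    value-at-position : ∀ {e} (e<n : e < n) → toℕ (π ⟨$⟩ʳ position e<n) ≡ e
    value-at-position e<n = trans (cong toℕ (inverseʳ π)) (toℕ-fromℕ< e<n)

    position∈window : ∀ {u v i j e} → Window u v i j → (e<n : e < n) →
                      InI u v (toℕ (position e<n)) ⇔ InI i j e
    position∈window {u} {v} {i} {j} w e<n =
      subst (λ z → InI u v (toℕ (position e<n)) ⇔ InI i j z) (value-at-position e<n) (w (position e<n))

    window⁻¹ : ∀ {u v i j} → Window u v i j → ∀ p → InI i j (toℕ p) → InI u v (toℕ (π ⟨$⟩ˡ p))
    window⁻¹ {i = i} {j} w p e∈ = from (w (π ⟨$⟩ˡ p)) (subst (λ z → InI i j (toℕ z)) (sym (inverseʳ π)) e∈)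

    window-size : ∀ {u v i j} → Window u v i j → u ≤ v → v < n → i ≤ j → j < n → v ∸ u ≡ j ∸ i
    window-size w u≤v v<n i≤j j<n = ≤-antisym
      (injection-size-≤ (π ⟨$⟩ʳ_) (Injection.injective (↔⇒↣ π)) u≤v v<n (λ p → to (w p)))
      (injection-size-≤ (π ⟨$⟩ˡ_) (Injection.injective (↔⇒↣ (flip π))) i≤j j<n (window⁻¹ w))

    window-fits : ∀ {s i j} → Window s (s + (j ∸ i)) i j → i ≤ j → j < n → s + (j ∸ i) < n
    window-fits {s} {i} {j} w i≤j j<n = begin-strict
      s + (j ∸ i)           ≤⟨ +-monoʳ-≤ s values≤positions ⟩
      s + (pred n ∸ s)      ≡⟨ m+[n∸m]≡n s≤pred-n ⟩
      pred n                <⟨ ≤-reflexive (suc-pred n {{>-nonZero (≤-<-trans z≤n j<n)}}) ⟩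
      n                     ∎
      where
      open ≤-Reasoning
      pred-bound : ∀ (p : Fin n) → toℕ p ≤ pred n
      pred-bound p = <⇒≤pred (toℕ<n p)
      i<n : i < n
      i<n = ≤-<-trans i≤j j<n
      s≤pred-n : s ≤ pred n
      s≤pred-n = ≤-trans (proj₁ (from (position∈window w i<n) (≤-refl , i≤j))) (pred-bound (position i<n))
      values≤positions : j ∸ i ≤ pred n ∸ s
      values≤positions = injection-size-≤ (π ⟨$⟩ˡ_) (Injection.injective (↔⇒↣ (flip π))) i≤j j<n
        (λ p e∈ → proj₁ (window⁻¹ w p e∈) , pred-bound (π ⟨$⟩ˡ p))

    window-transport : ∀ {u v i j} (X Y : ℕ → Set) → (∀ p → InI u v p ⇔ X p) → (∀ e → InI i j e ⇔ Y e) →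
                       (∀ p → X (toℕ p) ⇔ Y (toℕ (π ⟨$⟩ʳ p))) → Window u v i j
    window-transport X Y u⇔X i⇔Y X⇔Y p = ⇔-sym (i⇔Y (toℕ (π ⟨$⟩ʳ p))) ⇔-∘ (X⇔Y p ⇔-∘ u⇔X (toℕ p))

record OverlapClosure (C : ℕ → ℕ → Set) (i j k l : ℕ) : Set where
  field
    ∩-closed     : C k j
    ∪-closed     : C i l
    left-closed  : C i (pred k)
    right-closed : C (suc j) l

InI⇒≤ : ∀ {x y c} → InI x y c → x ≤ y
InI⇒≤ (xc , cy) = ≤-trans xc cy

consecutive-overlap-closure : ∀ {n} (π : Permutation′ n) {i j k l} → Consecutive π i j → Consecutive π k l →
                              i < k → k ≤ j → j < l → l < n → OverlapClosure (Consecutive π) i j k l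
consecutive-overlap-closure {n} π {i} {j} {k} {l} (s , u , _ , u<n , wA) (t , v , _ , v<n , wB) i<k k≤j j<l l<n = record
  { ∩-closed     = s ⊔ t , u ⊓ v , InI⇒≤ (from (∩-InI s u t v _) (cA , cB)) , ≤-<-trans (m⊓n≤m u v) u<n ,
                   window-transport π _ _ (∩-InI s u t v) (staggered-∩ (<⇒≤ i<k) (<⇒≤ j<l)) (λ p → wA p ×-⇔ wB p)
  ; ∪-closed     = s ⊓ t , u ⊔ v , InI⇒≤ (from (∪-InI cA cB _) (inj₁ cA)) , ⊔-lub u<n v<n ,
                   window-transport π _ _ (∪-InI cA cB) (staggered-∪ (<⇒≤ i<k) k≤1+j (<⇒≤ j<l)) (λ p → wA p ⊎-⇔ wB p)
  ; left-closed  = let (x , y , x≤y , y≤u , A∖B) = ∖-InI cA cB aA a∉B bB b∉A in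
                   x , y , x≤y , ≤-<-trans y≤u u<n ,
                   window-transport π _ _ A∖B (left-∖ i<k k≤j (<⇒≤ j<l)) (λ p → wA p ×-⇔ ¬-cong-⇔ (wB p))
  ; right-closed = let (x , y , x≤y , y≤v , B∖A) = ∖-InI cB cA bB b∉A aA a∉B in
                   x , y , x≤y , ≤-<-trans y≤v v<n ,
                   window-transport π _ _ B∖A (suffix-∖ (<⇒≤ i<k) k≤1+j) (λ p → wB p ×-⇔ ¬-cong-⇔ (wA p))
  }
  where
  k≤1+j : k ≤ suc j
  k≤1+j = ≤-trans k≤j (n≤1+n j)
  k≤l : k ≤ l
  k≤l = ≤-trans k≤j (<⇒≤ j<l)
  k<n : k < n
  k<n = ≤-<-trans k≤l l<n
  i<n : i < n
  i<n = <-trans i<k k<n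
  cA : InI s u (toℕ (position π k<n))
  cA = from (position∈window π wA k<n) (<⇒≤ i<k , k≤j)
  cB : InI t v (toℕ (position π k<n))
  cB = from (position∈window π wB k<n) (≤-refl , k≤l)
  aA : InI s u (toℕ (position π i<n))
  aA = from (position∈window π wA i<n) (≤-refl , ≤-trans (<⇒≤ i<k) k≤j)
  a∉B : ¬ InI t v (toℕ (position π i<n))
  a∉B a∈B = <⇒≱ i<k (proj₁ (to (position∈window π wB i<n) a∈B))
  bB : InI t v (toℕ (position π l<n))
  bB = from (position∈window π wB l<n) (k≤l , ≤-refl)
  b∉A : ¬ InI s u (toℕ (position π l<n))
  b∉A b∈A = <⇒≱ j<l (proj₂ (to (position∈window π wA l<n) b∈A))

-- Common intervals

_⇔?_ : ∀ {A B : Set} → Dec A → Dec B → Dec (A ⇔ B)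
a? ⇔? b? = map′ (λ (f , g) → mk⇔ f g) (λ e → to e , from e) ((a? →-dec b?) ×-dec (b? →-dec a?))

module _ {n K : ℕ} (P : Fin K → Permutation′ n) where

  common⇒consecutive : ∀ {i j} → Common P i j → ∀ q → Consecutive (P q) i j
  common⇒consecutive {i} {j} (i≤j , j<n , windows) q =
    let (s , w) = windows q in s , s + (j ∸ i) , m≤m+n s _ , window-fits (P q) w i≤j j<n , w

  consecutive⇒common : ∀ {i j} → i ≤ j → j < n → (∀ q → Consecutive (P q) i j) → Common P i j
  consecutive⇒common {i} {j} i≤j j<n cons = i≤j , j<n , λ q →
    let (u , v , u≤v , v<n , w) = cons q
        v≡u+[j∸i] = trans (sym (m+[n∸m]≡n u≤v)) (cong (u +_) (window-size (P q) w u≤v v<n i≤j j<n))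
    in u , subst (λ z → Window (P q) u z i j) v≡u+[j∸i] w

  common-overlap-closure : ∀ {i j k l} → Common P i j → Common P k l → i < k → k ≤ j → j < l →
                           OverlapClosure (Common P) i j k l
  common-overlap-closure {i} {j} {k} {l} cij@(i≤j , j<n , _) ckl@(_ , l<n , _) i<k k≤j j<l = record
    { ∩-closed     = consecutive⇒common k≤j j<n (OverlapClosure.∩-closed ∘ closure)
    ; ∪-closed     = consecutive⇒common (≤-trans i≤j (<⇒≤ j<l)) l<n (OverlapClosure.∪-closed ∘ closure)
    ; left-closed  = consecutive⇒common (<⇒≤pred i<k) (≤-<-trans (≤-trans pred[n]≤n k≤j) j<n)
                                        (OverlapClosure.left-closed ∘ closure)
    ; right-closed = consecutive⇒common j<l l<n (OverlapClosure.right-closed ∘ closure)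
    }
    where
    closure : ∀ q → OverlapClosure (Consecutive (P q)) i j k l
    closure q = consecutive-overlap-closure (P q) (common⇒consecutive cij q) (common⇒consecutive ckl q) i<k k≤j j<l l<n

  common-singleton : ∀ {i} → i < n → Common P i i
  common-singleton {i} i<n = consecutive⇒common ≤-refl i<n λ q →
    let p = position (P q) i<n in
    toℕ p , toℕ p , ≤-refl , toℕ<n p , λ p′ →
      ⇔-sym InI-singleton ⇔-∘ (at-i q p′ ⇔-∘ InI-singleton)
    where
    at-i : ∀ q p′ → (toℕ p′ ≡ toℕ (position (P q) i<n)) ⇔ (toℕ (P q ⟨$⟩ʳ p′) ≡ i)
    at-i q p′ = mk⇔
      (λ eq → trans (cong (toℕ ∘ (P q ⟨$⟩ʳ_)) (toℕ-injective eq)) (value-at-position (P q) i<n))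
      (λ eq → cong toℕ (Injection.injective (↔⇒↣ (P q))
                (toℕ-injective (trans eq (sym (value-at-position (P q) i<n))))))

  common? : ∀ i j → Dec (Common P i j)
  common? i j with i ≤? j | j <? n
  ... | no i≰j  | _       = no (i≰j ∘ proj₁)
  ... | yes _   | no j≮n  = no (j≮n ∘ proj₁ ∘ proj₂)
  ... | yes i≤j | yes j<n = map′ (λ w → i≤j , j<n , λ q → toℕ (proj₁ (w q)) , proj₂ (w q)) bounded-start
    (all? λ q → any? λ s → all? λ p → InI? (toℕ s) (toℕ s + (j ∸ i)) (toℕ p) ⇔? InI? i j (toℕ (P q ⟨$⟩ʳ p)))
    where
    bounded-start : Common P i j → ∀ q → ∃[ s ] Window (P q) (toℕ s) (toℕ s + (j ∸ i)) i j
    bounded-start (_ , _ , windows) q =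
      let (s , w) = windows q
          i<n = ≤-<-trans i≤j j<n
          s<n = ≤-<-trans (proj₁ (from (position∈window (P q) w i<n) (≤-refl , i≤j))) (toℕ<n (position (P q) i<n))
      in fromℕ< s<n , subst (λ z → Window (P q) z (z + (j ∸ i)) i j) (sym (toℕ-fromℕ< s<n)) w

-- Strong intervals and their children

module _ {n K : ℕ} (P : Fin K → Permutation′ n) where

  child-strong : ∀ {a c k l} → Child P a c k l → Strong P k l
  child-strong = proj₁ ∘ proj₂

  child-⊂ : ∀ {a c k l} → Child P a c k l → StrictSub k l a c
  child-⊂ = proj₁ ∘ proj₂ ∘ proj₂

  child-≤ : ∀ {a c k l} → Child P a c k l → k ≤ l
  child-≤ = proj₁ ∘ proj₁ ∘ child-strong

  strong-laminar : ∀ {a c k l e} → Strong P a c → Common P k l → InI a c e → InI k l e →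
                   Sub k l a c ⊎ Sub a c k l
  strong-laminar sac ckl = laminar (proj₂ sac _ _ ckl)

  ¬strong⇒overlapped : ∀ {i j} → Common P i j → ¬ Strong P i j →
                       DN (∃[ k ] ∃[ l ] (Common P k l × Overlap i j k l))
  ¬strong⇒overlapped cij ¬sij none = ¬sij (cij , λ k l ckl ov → none (k , l , ckl , ov))

  above-child⇒¬strong : ∀ {a c k l w₁ w₂} → Child P a c k l → StrictSub k l w₁ w₂ → ¬ Sub a c w₁ w₂ →
                        ¬ Strong P w₁ w₂
  above-child⇒¬strong (_ , _ , _ , maximal) kl⊂w ac⊈w sw = ac⊈w (maximal _ _ sw kl⊂w)

  child-maximal : ∀ {a c k l z₁ z₂} → Child P a c k l → Strong P z₁ z₂ → Sub k l z₁ z₂ → ¬ Sub a c z₁ z₂ →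
                  k ≡ z₁ × l ≡ z₂
  child-maximal ch sz kl⊆z ac⊈z with ⊆⇒≡⊎⊂ kl⊆z
  ... | inj₁ ends≡ = ends≡
  ... | inj₂ kl⊂z  = contradiction sz (above-child⇒¬strong ch kl⊂z ac⊈z)

  children-meeting-≡ : ∀ {a c k l k′ l′ e} → Child P a c k l → Child P a c k′ l′ → InI k l e → InI k′ l′ e →
                       k ≡ k′ × l ≡ l′
  children-meeting-≡ ch ch′ e∈kl e∈kl′ with strong-laminar (child-strong ch) (proj₁ (child-strong ch′)) e∈kl e∈kl′
  ... | inj₁ kl′⊆kl = let (k′≡k , l′≡l) = child-maximal ch′ (child-strong ch) kl′⊆kl (⊂⇒⊉ (child-⊂ ch))
                      in sym k′≡k , sym l′≡l
  ... | inj₂ kl⊆kl′ = child-maximal ch (child-strong ch′) kl⊆kl′ (⊂⇒⊉ (child-⊂ ch′))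

  overlapping⊆strong : ∀ {a c w₁ w₂ v₁ v₂} → Strong P a c → Sub w₁ w₂ a c → Common P v₁ v₂ →
                       Overlap w₁ w₂ v₁ v₂ → Sub v₁ v₂ a c
  overlapping⊆strong sac w⊆ac cv ov with overlap-point ov
  ... | e , e∈w , e∈v with strong-laminar sac cv (⊆-trans e∈w w⊆ac) e∈v
  ...   | inj₁ v⊆ac = v⊆ac
  ...   | inj₂ ac⊆v = contradiction (⊆-trans w⊆ac ac⊆v) (overlap⇒⊈ ov)

  strong-singleton : ∀ {i} → i < n → Strong P i i
  strong-singleton i<n = common-singleton P i<n , λ _ _ _ → λ
    { (inj₁ (i<k , k≤i , _)) → <⇒≱ i<k k≤i
    ; (inj₂ (_ , i≤l , l<i)) → <⇒≱ l<i i≤l }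

  singleton-childless : ∀ {i k l} → ¬ Child P i i k l
  singleton-childless ch with child-⊂ ch | child-≤ ch
  ... | (i≤k , l≤i) , inj₁ i<k | k≤l = <⇒≱ i<k (≤-trans k≤l l≤i)
  ... | (i≤k , l≤i) , inj₂ l<i | k≤l = <⇒≱ l<i (≤-trans i≤k k≤l)

  P-interval-singleton : ∀ {i} → i < n → PInterval P i i
  P-interval-singleton i<n = strong-singleton i<n , λ
    { (_ , [] , _ , () , _)
    ; (_ , (_ ∷ _) , _ , _ , (ch ∷ _) , _) → singleton-childless ch }

  strong⇒covered-by-children : ∀ {a c e} → Strong P a c → a < c → InI a c e →
                               DN (∃[ y₁ ] ∃[ y₂ ] (Child P a c y₁ y₂ × InI y₁ y₂ e))
  strong⇒covered-by-children {a} {c} {e} sac a<c e∈ac =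
    DN-descent measure Below climb (e , e) (strong-singleton e<n , e∈ac , ac⊈e , (≤-refl , ≤-refl))
    where
    e<n : e < n
    e<n = ≤-<-trans (proj₂ e∈ac) (proj₁ (proj₂ (proj₁ sac)))
    ac⊈e : ¬ Sub a c e e
    ac⊈e (e≤a , c≤e) = <⇒≱ a<c (≤-trans c≤e e≤a)
    Below : ℕ × ℕ → Set
    Below (t₁ , t₂) = Strong P t₁ t₂ × Sub t₁ t₂ a c × ¬ Sub a c t₁ t₂ × InI t₁ t₂ e
    measure : ℕ × ℕ → ℕ
    measure (t₁ , t₂) = (c ∸ a) ∸ (t₂ ∸ t₁)
    Above : ℕ → ℕ → Set
    Above t₁ t₂ = ∃[ t₁′ ] ∃[ t₂′ ] (Strong P t₁′ t₂′ × StrictSub t₁ t₂ t₁′ t₂′ × ¬ Sub a c t₁′ t₂′)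
    climb : ∀ t → Below t → DN ((∃[ y₁ ] ∃[ y₂ ] (Child P a c y₁ y₂ × InI y₁ y₂ e)) ⊎
                                ∃[ t′ ] (Below t′ × measure t′ < measure t))
    climb (t₁ , t₂) (st , t⊆ac , ac⊈t , e∈t) = ¬¬-excluded-middle {A = Above t₁ t₂} >>= λ
      { (no none) → pure (inj₁ (t₁ , t₂ , (sac , st , t⊂ac ,
          λ a′ c′ s′ t⊂′ → decidable-stable (Sub? a c a′ c′) (λ ac⊈′ → none (a′ , c′ , s′ , t⊂′ , ac⊈′))) , e∈t))
      ; (yes (t₁′ , t₂′ , st′ , t⊂t′ , ac⊈t′)) →
          pure (inj₂ ((t₁′ , t₂′) , (st′ , t′⊆ac t₁′ t₂′ st′ t⊂t′ ac⊈t′ , ac⊈t′ , ⊆-trans e∈t (proj₁ t⊂t′)) ,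
                      ∸-monoʳ-< (⊂⇒size< (proj₁ (proj₁ st)) t⊂t′) (⊆⇒size≤ (t′⊆ac t₁′ t₂′ st′ t⊂t′ ac⊈t′)))) }
      where
      t⊂ac : StrictSub t₁ t₂ a c
      t⊂ac = [ (λ { (refl , refl) → contradiction (≤-refl , ≤-refl) ac⊈t }) , id ]′ (⊆⇒≡⊎⊂ t⊆ac)
      t′⊆ac : ∀ t₁′ t₂′ → Strong P t₁′ t₂′ → StrictSub t₁ t₂ t₁′ t₂′ → ¬ Sub a c t₁′ t₂′ → Sub t₁′ t₂′ a c
      t′⊆ac t₁′ t₂′ st′ t⊂t′ ac⊈t′ =
        [ id , (λ ac⊆t′ → contradiction ac⊆t′ ac⊈t′) ]′
          (strong-laminar sac (proj₁ st′) (⊆-trans e∈t t⊆ac) (⊆-trans e∈t (proj₁ t⊂t′)))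

  Cover : ℕ → ℕ → Set
  Cover a c = ∃[ p ] ∃[ s ] (Common P a p × Common P s c × a < s × s ≤ p × p < c)

  widen-to-cover : ∀ {a c x₁ x₂ y₁ y₂} → Common P x₁ x₂ → Common P y₁ y₂ → x₁ < y₁ → y₁ ≤ x₂ → x₂ < y₂ →
                   Sub x₁ y₂ a c → Cover a c ⊎ (Common P x₁ y₂ × ¬ Sub a c x₁ y₂)
  widen-to-cover {a} {c} {x₁} {x₂} {y₁} {y₂} cx cy x₁<y₁ y₁≤x₂ x₂<y₂ (a≤x₁ , y₂≤c) with Sub? a c x₁ y₂
  ... | no ac⊈ = inj₂ (OverlapClosure.∪-closed (common-overlap-closure P cx cy x₁<y₁ y₁≤x₂ x₂<y₂) , ac⊈)
  ... | yes (x₁≤a , c≤y₂) with ≤-antisym x₁≤a a≤x₁ | ≤-antisym y₂≤c c≤y₂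
  ...   | refl | refl = inj₁ (x₂ , y₁ , cx , cy , x₁<y₁ , y₁≤x₂ , x₂<y₂)

  -- Repeatedly adjoin an overlapping interval to the union of the children witnessing the Q label;
  -- since that union misses a child it never becomes strong before it covers (a..c).
  qnode⇒cover : ∀ {a c} → QNode P a c → DN (Cover a c)
  qnode⇒cover (_ , [] , _ , () , _)
  qnode⇒cover (_ , _ ∷ [] , _ , s≤s () , _)
  qnode⇒cover {a} {c} (sac , D@(d₁ ∷ d₂ ∷ _) , ((d₁≢d₂ ∷ _) ∷ _) , _ , children@(ch₁ ∷ ch₂ ∷ _) ,
                       ((k₀ , l₀) , ch₀ , x₀∉D) , u , v , cuv , ⋃D) =
    DN-descent measure Grown widen (u , v) (cuv , uv⊆ac , ac⊈uv , (_ , _ , ch₁ , d₁⊂uv))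
    where
    member : ∀ {e} → InI u v e → ∃[ x ] (x ∈ D × Child P a c (proj₁ x) (proj₂ x) × InI (proj₁ x) (proj₂ x) e)
    member e∈ = let (x , x∈D , e∈x) = find (to (⋃D _) e∈) in x , x∈D , lookup children x∈D , e∈x
    uv⊆ac : Sub u v a c
    uv⊆ac = let (_ , _ , chᵤ , u∈) = member (≤-refl , proj₁ cuv)
                (_ , _ , chᵥ , v∈) = member (proj₁ cuv , ≤-refl)
            in ≤-trans (proj₁ (proj₁ (child-⊂ chᵤ))) (proj₁ u∈) , ≤-trans (proj₂ v∈) (proj₂ (proj₁ (child-⊂ chᵥ)))
    ac⊈uv : ¬ Sub a c u v
    ac⊈uv (u≤a , c≤v) =
      let k₀≤l₀ = child-≤ ch₀
          (a≤k₀ , l₀≤c) = proj₁ (child-⊂ ch₀)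
          (x , x∈D , chₓ , k₀∈x) = member (≤-trans u≤a a≤k₀ , ≤-trans (≤-trans k₀≤l₀ l₀≤c) c≤v)
          (k₀≡ , l₀≡) = children-meeting-≡ ch₀ chₓ (≤-refl , k₀≤l₀) k₀∈x
      in x₀∉D (subst (_∈ D) (sym (cong₂ _,_ k₀≡ l₀≡)) x∈D)
    d₁⊂uv : StrictSub (proj₁ d₁) (proj₂ d₁) u v
    d₁⊂uv with ⊆⇒≡⊎⊂ (proj₁ (from (⋃D _) (here (≤-refl , child-≤ ch₁))) , proj₂ (from (⋃D _) (here (child-≤ ch₁ , ≤-refl))))
    ... | inj₂ d₁⊂ = d₁⊂
    ... | inj₁ (refl , refl) = contradiction (cong₂ _,_ (proj₁ d₁≡d₂) (proj₂ d₁≡d₂)) d₁≢d₂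
      where
      d₁≡d₂ : proj₁ d₁ ≡ proj₁ d₂ × proj₂ d₁ ≡ proj₂ d₂
      d₁≡d₂ = children-meeting-≡ ch₁ ch₂ (from (⋃D _) (there (here (≤-refl , child-≤ ch₂)))) (≤-refl , child-≤ ch₂)
    Grown : ℕ × ℕ → Set
    Grown (w₁ , w₂) = Common P w₁ w₂ × Sub w₁ w₂ a c × ¬ Sub a c w₁ w₂ ×
                      ∃[ y₁ ] ∃[ y₂ ] (Child P a c y₁ y₂ × StrictSub y₁ y₂ w₁ w₂)
    measure : ℕ × ℕ → ℕ
    measure (w₁ , w₂) = (c ∸ a) ∸ (w₂ ∸ w₁)
    widen : ∀ w → Grown w → DN (Cover a c ⊎ ∃[ w′ ] (Grown w′ × measure w′ < measure w))
    widen (w₁ , w₂) (cw , w⊆ac , ac⊈w , (y₁ , y₂ , chy , y⊂w)) = do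
      (v₁ , v₂ , cv , ov) ← ¬strong⇒overlapped cw (above-child⇒¬strong chy y⊂w ac⊈w)
      pure (adjoin cv ov (overlapping⊆strong sac w⊆ac cv ov))
      where
      grown : ∀ {x₁ x₂} → Sub x₁ x₂ a c → StrictSub w₁ w₂ x₁ x₂ →
              Cover a c ⊎ (Common P x₁ x₂ × ¬ Sub a c x₁ x₂) →
              Cover a c ⊎ ∃[ w′ ] (Grown w′ × measure w′ < measure (w₁ , w₂))
      grown _ _ (inj₁ cover) = inj₁ cover
      grown x⊆ac w⊂x (inj₂ (cx , ac⊈x)) = inj₂ (_ , (cx , x⊆ac , ac⊈x , (y₁ , y₂ , chy , ⊂-⊆-trans y⊂w (proj₁ w⊂x))) ,
        ∸-monoʳ-< (⊂⇒size< (proj₁ cw) w⊂x) (⊆⇒size≤ x⊆ac))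
      adjoin : ∀ {v₁ v₂} → Common P v₁ v₂ → Overlap w₁ w₂ v₁ v₂ → Sub v₁ v₂ a c →
               Cover a c ⊎ ∃[ w′ ] (Grown w′ × measure w′ < measure (w₁ , w₂))
      adjoin cv (inj₁ (w₁<v₁ , v₁≤w₂ , w₂<v₂)) (_ , v₂≤c) =
        grown (proj₁ w⊆ac , v₂≤c) ((≤-refl , <⇒≤ w₂<v₂) , inj₂ w₂<v₂)
              (widen-to-cover cw cv w₁<v₁ v₁≤w₂ w₂<v₂ (proj₁ w⊆ac , v₂≤c))
      adjoin cv (inj₂ (v₁<w₁ , w₁≤v₂ , v₂<w₂)) (a≤v₁ , _) =
        grown (a≤v₁ , proj₂ w⊆ac) ((<⇒≤ v₁<w₁ , ≤-refl) , inj₁ v₁<w₁)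
              (widen-to-cover cv cw v₁<w₁ w₁≤v₂ v₂<w₂ (a≤v₁ , proj₂ w⊆ac))

  module _ {a c s e e′} (left : Child P a c s e) (right : Child P a c (suc e) e′) where

    private
      Straddles : ℕ × ℕ → Set
      Straddles (w₁ , w₂) = Common P w₁ w₂ × w₁ ≤ e × e < w₂

      Shrinks : ℕ → ℕ → Set
      Shrinks w₁ w₂ = ∃[ w₁′ ] ∃[ w₂′ ] (Straddles (w₁′ , w₂′) × StrictSub w₁′ w₂′ w₁ w₂)

      pred< : ∀ {m k} → m < k → pred k < k
      pred< {k = suc k} _ = ≤-refl

      s≤e : s ≤ e
      s≤e = child-≤ left

      e<e′ : e < e′
      e<e′ = child-≤ right

      a≤e : a ≤ e
      a≤e = ≤-trans (proj₁ (proj₁ (child-⊂ left))) s≤e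

      e<c : e < c
      e<c = <-≤-trans e<e′ (proj₂ (proj₁ (child-⊂ right)))

      width : ℕ × ℕ → ℕ
      width (w₁ , w₂) = w₂ ∸ w₁

      shrink-∩ʳ : ∀ {w₁ w₂ v₁ v₂} → Common P w₁ w₂ → Common P v₁ v₂ → w₁ < v₁ → v₁ ≤ w₂ → w₂ < v₂ →
                  e < w₂ → v₁ ≤ e → Shrinks w₁ w₂
      shrink-∩ʳ cw cv w₁<v₁ v₁≤w₂ w₂<v₂ e<w₂ v₁≤e =
        _ , _ , (OverlapClosure.∩-closed (common-overlap-closure P cw cv w₁<v₁ v₁≤w₂ w₂<v₂) , v₁≤e , e<w₂) ,
        (<⇒≤ w₁<v₁ , ≤-refl) , inj₁ w₁<v₁

      shrink-∖ʳ : ∀ {w₁ w₂ v₁ v₂} → Common P w₁ w₂ → Common P v₁ v₂ → w₁ < v₁ → v₁ ≤ w₂ → w₂ < v₂ →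
                  w₁ ≤ e → suc e < v₁ → Shrinks w₁ w₂
      shrink-∖ʳ cw cv w₁<v₁ v₁≤w₂ w₂<v₂ w₁≤e 1+e<v₁ =
        _ , _ , (OverlapClosure.left-closed (common-overlap-closure P cw cv w₁<v₁ v₁≤w₂ w₂<v₂) , w₁≤e , <⇒≤pred 1+e<v₁) ,
        (≤-refl , ≤-trans pred[n]≤n v₁≤w₂) , inj₂ (<-≤-trans (pred< 1+e<v₁) v₁≤w₂)

      shrink-∩ˡ : ∀ {w₁ w₂ v₁ v₂} → Common P w₁ w₂ → Common P v₁ v₂ → v₁ < w₁ → w₁ ≤ v₂ → v₂ < w₂ →
                  w₁ ≤ e → e < v₂ → Shrinks w₁ w₂
      shrink-∩ˡ cw cv v₁<w₁ w₁≤v₂ v₂<w₂ w₁≤e e<v₂ =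
        _ , _ , (OverlapClosure.∩-closed (common-overlap-closure P cv cw v₁<w₁ w₁≤v₂ v₂<w₂) , w₁≤e , e<v₂) ,
        (≤-refl , <⇒≤ v₂<w₂) , inj₂ v₂<w₂

      shrink-∖ˡ : ∀ {w₁ w₂ v₁ v₂} → Common P w₁ w₂ → Common P v₁ v₂ → v₁ < w₁ → w₁ ≤ v₂ → v₂ < w₂ →
                  e < w₂ → v₂ < e → Shrinks w₁ w₂
      shrink-∖ˡ cw cv v₁<w₁ w₁≤v₂ v₂<w₂ e<w₂ v₂<e =
        _ , _ , (OverlapClosure.right-closed (common-overlap-closure P cv cw v₁<w₁ w₁≤v₂ v₂<w₂) , v₂<e , e<w₂) ,
        (≤-trans w₁≤v₂ (n≤1+n _) , ≤-refl) , inj₁ (s≤s w₁≤v₂)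

      -- (w₁..w₂) is cut at e into two common intervals, one of which strictly contains a child
      -- and is therefore overlapped by a common interval that yields a smaller straddling one.
      cut : ∀ {w₁ w₂} → Common P w₁ w₂ → w₁ ≤ s → e′ ≤ w₂ → ¬ (w₁ ≡ s × w₂ ≡ e′) →
            Common P w₁ e → Common P (suc e) w₂ → DN (Shrinks w₁ w₂)
      cut {w₁} {w₂} cw w₁≤s e′≤w₂ w≢ cl cr with e′ <? w₂
      ... | yes e′<w₂ = do
        (z₁ , z₂ , cz , ov) ← ¬strong⇒overlapped cr
          (above-child⇒¬strong right ((≤-refl , e′≤w₂) , inj₂ e′<w₂)
                                     (λ (1+e≤a , _) → <⇒≱ 1+e≤a a≤e))
        pure (from-right cz ov)
        where
        w₁≤e : w₁ ≤ e
        w₁≤e = ≤-trans w₁≤s s≤e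
        e<w₂ : e < w₂
        e<w₂ = <-≤-trans e<e′ e′≤w₂
        from-right : ∀ {z₁ z₂} → Common P z₁ z₂ → Overlap (suc e) w₂ z₁ z₂ → Shrinks w₁ w₂
        from-right cz (inj₁ (1+e<z₁ , z₁≤w₂ , w₂<z₂)) =
          shrink-∖ʳ cw cz (≤-<-trans w₁≤e (<-trans (n<1+n e) 1+e<z₁)) z₁≤w₂ w₂<z₂ w₁≤e 1+e<z₁
        from-right {z₁} cz (inj₂ (z₁<1+e , 1+e≤z₂ , z₂<w₂)) with w₁ ≤? z₁
        ... | yes w₁≤z₁ = _ , _ , (cz , s≤s⁻¹ z₁<1+e , 1+e≤z₂) , (w₁≤z₁ , <⇒≤ z₂<w₂) , inj₂ z₂<w₂
        ... | no  w₁≰z₁ = shrink-∩ˡ cw cz (≰⇒> w₁≰z₁) (≤-trans w₁≤e (<⇒≤ 1+e≤z₂)) z₂<w₂ w₁≤e 1+e≤z₂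
      ... | no  e′≮w₂ = do
        (z₁ , z₂ , cz , ov) ← ¬strong⇒overlapped cl
          (above-child⇒¬strong left ((w₁≤s , ≤-refl) , inj₁ w₁<s)
                                    (λ (_ , c≤e) → <⇒≱ e<c c≤e))
        pure (from-left cz ov)
        where
        w₁<s : w₁ < s
        w₁<s = ≤∧≢⇒< w₁≤s (λ w₁≡s → w≢ (w₁≡s , ≤-antisym (≮⇒≥ e′≮w₂) e′≤w₂))
        w₁≤e : w₁ ≤ e
        w₁≤e = ≤-trans w₁≤s s≤e
        e<w₂ : e < w₂
        e<w₂ = <-≤-trans e<e′ e′≤w₂
        from-left : ∀ {z₁ z₂} → Common P z₁ z₂ → Overlap w₁ e z₁ z₂ → Shrinks w₁ w₂
        from-left {z₁} {z₂} cz (inj₁ (w₁<z₁ , z₁≤e , e<z₂)) with z₂ ≤? w₂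
        ... | yes z₂≤w₂ = _ , _ , (cz , z₁≤e , e<z₂) , (<⇒≤ w₁<z₁ , z₂≤w₂) , inj₁ w₁<z₁
        ... | no  z₂≰w₂ = shrink-∩ʳ cw cz w₁<z₁ (≤-trans z₁≤e (<⇒≤ e<w₂)) (≰⇒> z₂≰w₂) e<w₂ z₁≤e
        from-left cz (inj₂ (z₁<w₁ , w₁≤z₂ , z₂<e)) =
          shrink-∖ˡ cw cz z₁<w₁ w₁≤z₂ (<-trans z₂<e e<w₂) e<w₂ z₂<e

      split : ∀ {w₁ w₂ v₁ v₂} → Common P w₁ w₂ → w₁ ≤ e → e < w₂ → w₁ ≤ s → e′ ≤ w₂ → ¬ (w₁ ≡ s × w₂ ≡ e′) →
              Common P v₁ v₂ → Overlap w₁ w₂ v₁ v₂ → DN (Shrinks w₁ w₂)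
      split {v₁ = v₁} cw w₁≤e e<w₂ w₁≤s e′≤w₂ w≢ cv (inj₁ (w₁<v₁ , v₁≤w₂ , w₂<v₂)) with <-cmp v₁ (suc e)
      ... | tri< v₁<1+e _ _ = pure (shrink-∩ʳ cw cv w₁<v₁ v₁≤w₂ w₂<v₂ e<w₂ (s≤s⁻¹ v₁<1+e))
      ... | tri> _ _ 1+e<v₁ = pure (shrink-∖ʳ cw cv w₁<v₁ v₁≤w₂ w₂<v₂ w₁≤e 1+e<v₁)
      ... | tri≈ _ refl _   = let o = common-overlap-closure P cw cv w₁<v₁ v₁≤w₂ w₂<v₂ in
                              cut cw w₁≤s e′≤w₂ w≢ (OverlapClosure.left-closed o) (OverlapClosure.∩-closed o)
      split {v₂ = v₂} cw w₁≤e e<w₂ w₁≤s e′≤w₂ w≢ cv (inj₂ (v₁<w₁ , w₁≤v₂ , v₂<w₂)) with <-cmp v₂ e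
      ... | tri< v₂<e _ _ = pure (shrink-∖ˡ cw cv v₁<w₁ w₁≤v₂ v₂<w₂ e<w₂ v₂<e)
      ... | tri> _ _ e<v₂ = pure (shrink-∩ˡ cw cv v₁<w₁ w₁≤v₂ v₂<w₂ w₁≤e e<v₂)
      ... | tri≈ _ refl _ = let o = common-overlap-closure P cv cw v₁<w₁ w₁≤v₂ v₂<w₂ in
                            cut cw w₁≤s e′≤w₂ w≢ (OverlapClosure.∩-closed o) (OverlapClosure.right-closed o)

      through-cover : ∀ {w₁ w₂} → Cover a c → Sub a c w₁ w₂ → Shrinks w₁ w₂
      through-cover (p , q , cap , cqc , a<q , q≤p , p<c) (w₁≤a , c≤w₂) with e <? p
      ... | yes e<p = _ , _ , (cap , a≤e , e<p) , (w₁≤a , ≤-trans (<⇒≤ p<c) c≤w₂) ,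
                      inj₂ (<-≤-trans p<c c≤w₂)
      ... | no  e≮p = _ , _ , (cqc , ≤-trans q≤p (≮⇒≥ e≮p) , e<c) ,
                      (≤-trans w₁≤a (<⇒≤ a<q) , c≤w₂) , inj₁ (≤-<-trans w₁≤a a<q)

      shrink : Cover a c → ∀ w → Straddles w → DN (Common P s e′ ⊎ ∃[ w′ ] (Straddles w′ × width w′ < width w))
      shrink cover (w₁ , w₂) (cw , w₁≤e , e<w₂) = map₂ smaller <$> attempt
        where
        smaller : Shrinks w₁ w₂ → ∃[ w′ ] (Straddles w′ × width w′ < w₂ ∸ w₁)
        smaller (w₁′ , w₂′ , st′@(cw′ , _) , w′⊂w) = (w₁′ , w₂′) , st′ , ⊂⇒size< (proj₁ cw′) w′⊂w
        attempt : DN (Common P s e′ ⊎ Shrinks w₁ w₂)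
        attempt with Sub? a c w₁ w₂
        ... | yes ac⊆w = pure (inj₂ (through-cover cover ac⊆w))
        ... | no ac⊈w with (w₁ ≟ s) ×-dec (w₂ ≟ e′)
        ...   | yes (refl , refl) = pure (inj₁ cw)
        ...   | no w≢ = do
          (v₁ , v₂ , cv , ov) ← ¬strong⇒overlapped cw (above-child⇒¬strong left ((w₁≤s , <⇒≤ e<w₂) , inj₂ e<w₂) ac⊈w)
          inj₂ <$> split cw w₁≤e e<w₂ w₁≤s e′≤w₂ w≢ cv ov
          where
          e∈w : InI w₁ w₂ e
          e∈w = w₁≤e , <⇒≤ e<w₂
          w₁≤s : w₁ ≤ s
          w₁≤s = [ (λ (_ , w₂≤e) → contradiction w₂≤e (<⇒≱ e<w₂)) , proj₁ ]′
                   (strong-laminar (child-strong left) cw (s≤e , ≤-refl) e∈w)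
          e′≤w₂ : e′ ≤ w₂
          e′≤w₂ = [ (λ (1+e≤w₁ , _) → contradiction 1+e≤w₁ (<⇒≱ (s≤s w₁≤e))) , proj₂ ]′
                    (strong-laminar (child-strong right) cw (≤-refl , e<e′) (≤-trans w₁≤e (n≤1+n e) , e<w₂))

    adjacent-children-union : QNode P a c → DN (Common P s e′)
    adjacent-children-union q = do
      cover ← qnode⇒cover q
      DN-descent width Straddles (shrink cover) (a , c) (proj₁ (proj₁ q) , a≤e , e<c)

-- Runs of children

data Spans : List (ℕ × ℕ) → ℕ → Set where
  [-] : ∀ {x} → Spans [ x ] (proj₂ x)
  _∷_ : ∀ {x y L e} → suc (proj₂ x) ≡ proj₁ y → Spans (y ∷ L) e → Spans (x ∷ y ∷ L) e

Ordered : ℕ × ℕ → Set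
Ordered (k , l) = k ≤ l

linked⇒spans : ∀ zs z → Linked (λ x y → suc (proj₂ x) ≡ proj₁ y) (zs ++ [ z ]) → Spans (zs ++ [ z ]) (proj₂ z)
linked⇒spans []           z _        = [-]
linked⇒spans (_ ∷ [])     z (r ∷ _)  = r ∷ [-]
linked⇒spans (_ ∷ v ∷ zs) z (r ∷ lk) = r ∷ linked⇒spans (v ∷ zs) z lk

spans-link : ∀ {x y L e} → Spans (x ∷ y ∷ L) e → suc (proj₂ x) ≡ proj₁ y
spans-link (r ∷ _) = r

spans-tail : ∀ {x y L e} → Spans (x ∷ y ∷ L) e → Spans (y ∷ L) e
spans-tail (_ ∷ sp) = sp

spans-init : ∀ {w e} zs z → Spans ((w ∷ zs) ++ [ z ]) e → ∃[ p ] (Spans (w ∷ zs) p × suc p ≡ proj₁ z)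
spans-init []       z (r ∷ [-]) = _ , [-] , r
spans-init (v ∷ zs) z (r ∷ sp)  = let (p , sp′ , r′) = spans-init zs z sp in p , r ∷ sp′ , r′

spans-⊆ : ∀ {x L e w} → Spans (x ∷ L) e → All Ordered (x ∷ L) → w ∈ x ∷ L → Sub (proj₁ w) (proj₂ w) (proj₁ x) e
spans-⊆ [-]      _                (here refl) = ≤-refl , ≤-refl
spans-⊆ (r ∷ sp) (_ ∷ oy@(y≤ ∷ _)) (here refl) =
  ≤-refl , ≤-trans (n≤1+n _) (≤-trans (≤-reflexive r) (≤-trans y≤ (proj₂ (spans-⊆ sp oy (here refl)))))
spans-⊆ (r ∷ sp) (x≤ ∷ oy)         (there w∈) =
  let (y≤w , w≤e) = spans-⊆ sp oy w∈ in ≤-trans x≤ (≤-trans (n≤1+n _) (≤-trans (≤-reflexive r) y≤w)) , w≤e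

module _ {n K : ℕ} (P : Fin K → Permutation′ n) where

  IsChild : ℕ → ℕ → ℕ × ℕ → Set
  IsChild a c (k , l) = Child P a c k l

  children-ordered : ∀ {a c L} → All (IsChild a c) L → All Ordered L
  children-ordered = All.map (child-≤ P)

  -- The union of a gap-free run of children of a Q-node is common: glue adjacent pairs, then overlap.
  spanned-children-common : ∀ {a c x L e} → QNode P a c → All (IsChild a c) (x ∷ L) → Spans (x ∷ L) e →
                            DN (Common P (proj₁ x) e)
  spanned-children-common q (chx ∷ _) [-] = pure (proj₁ (child-strong P chx))
  spanned-children-common {a} {c} {x} {y ∷ _} q (chx ∷ chy ∷ chs) (r ∷ sp) = do
    cxy ← adjacent-children-union P chx (subst (λ z → Child P a c z _) (sym r) chy) q
    cye ← spanned-children-common q (chy ∷ chs) sp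
    pure (glue sp (children-ordered (chy ∷ chs)) cxy cye)
    where
    glue : ∀ {L e} → Spans (y ∷ L) e → All Ordered (y ∷ L) → Common P (proj₁ x) (proj₂ y) → Common P (proj₁ y) e →
           Common P (proj₁ x) e
    glue [-] _ cxy _ = cxy
    glue sp@(r′ ∷ _) ordered@(_ ∷ z≤ ∷ _) cxy cye = OverlapClosure.∪-closed
      (common-overlap-closure P cxy cye (≤-<-trans (child-≤ P chx) (≤-reflexive r)) (child-≤ P chy)
        (<-≤-trans (≤-reflexive r′) (≤-trans z≤ (proj₂ (spans-⊆ sp ordered (there (here refl)))))))

  record EndParts (i j e p : ℕ) : Set where
    field
      first-strong : Strong P i e
      last-strong  : Strong P (suc p) j
      e≤p          : e ≤ p
      after-first  : Common P (suc e) j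
      before-last  : Common P i p

    i≤e : i ≤ e
    i≤e = proj₁ (proj₁ first-strong)

    p<j : p < j
    p<j = proj₁ (proj₁ last-strong)

  module _ (b : ℕ) where

    nested⇒common : ∀ {i j} → Nested P b i j → Common P i j
    nested⇒common (base cii)       = cii
    nested⇒common (step cij _ _ _) = cij

    nested-⊇ : ∀ {a c k l} → Common P a c → Nested P b k l → Sub k l a c → suc (c ∸ a) ≤ suc (l ∸ k) + b →
               Nested P b a c
    nested-⊇ cac nkl kl⊆ac size with ⊆⇒≡⊎⊂ kl⊆ac
    ... | inj₁ (refl , refl) = nkl
    ... | inj₂ kl⊂ac         = step cac nkl kl⊂ac size

    rest-nested⇒nested : ∀ {i j k l} → Common P i j → Sub k l i j → k ≤ l → Small b k l →
                         RestNested P b i j k l → Nested P b i j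
    rest-nested⇒nested {i} {j} {k} {l} cij (i≤k , l≤j) k≤l small (a , c , rest , nac) =
      step cij nac ac⊂ij (≤-trans (cover-size (proj₁ cij) covered) (+-monoʳ-≤ (suc (c ∸ a)) small))
      where
      a≤c : a ≤ c
      a≤c = proj₁ (nested⇒common nac)
      ac⊆ij : Sub a c i j
      ac⊆ij = proj₁ (proj₁ (to (rest a) (≤-refl , a≤c))) , proj₂ (proj₁ (to (rest c) (a≤c , ≤-refl)))
      ac⊂ij : StrictSub a c i j
      ac⊂ij with ⊆⇒≡⊎⊂ ac⊆ij
      ... | inj₂ ac⊂ = ac⊂
      ... | inj₁ (refl , refl) = contradiction (≤-refl , k≤l) (proj₂ (to (rest k) (i≤k , ≤-trans k≤l l≤j)))
      covered : ∀ e → InI i j e → InI a c e ⊎ InI k l e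
      covered e e∈ij with InI? k l e
      ... | yes e∈kl = inj₂ e∈kl
      ... | no  e∉kl = inj₁ (from (rest e) (e∈ij , e∉kl))

    first-removable : ∀ {i j e p k l} → EndParts i j e p → Nested P b k l → e < k → l ≤ j →
                      suc (j ∸ i) ≤ suc (l ∸ k) + b → Small b i e × RestNested P b i j i e
    first-removable {i} {j} {e} parts nkl e<k l≤j size =
      part-small (disjoint-size ≤-refl i≤e e<k (proj₁ (nested⇒common nkl)) l≤j) size ,
      (suc e , j , suffix-∖ ≤-refl i≤1+e ,
       nested-⊇ after-first nkl (e<k , l≤j) (≤-trans (s≤s (∸-monoʳ-≤ j i≤1+e)) size))
      where
      open EndParts parts
      i≤1+e : i ≤ suc e
      i≤1+e = ≤-trans i≤e (n≤1+n e)

    last-removable : ∀ {i j e p k l} → EndParts i j e p → Nested P b k l → i ≤ k → l ≤ p →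
                     suc (j ∸ i) ≤ suc (l ∸ k) + b → Small b (suc p) j × RestNested P b i j (suc p) j
    last-removable {i} {j} {e} {p} parts nkl i≤k l≤p size =
      part-small (≤-trans (≤-reflexive (+-comm (suc (j ∸ suc p)) _))
                          (disjoint-size i≤k (proj₁ (nested⇒common nkl)) (s≤s l≤p) p<j ≤-refl)) size ,
      (i , p , prefix-∖ (<⇒≤ p<j) ≤-refl ,
       nested-⊇ before-last nkl (i≤k , l≤p) (≤-trans (s≤s (∸-monoˡ-≤ i (<⇒≤ p<j))) size))
      where open EndParts parts

    -- A nested interval strictly inside (i..j) cannot overlap a strong part, so it misses the first
    -- or the last part.
    nested⇒end-removable : ∀ {i j e p} → i < j → EndParts i j e p → Nested P b i j →
                           (Small b i e × RestNested P b i j i e) ⊎ (Small b (suc p) j × RestNested P b i j (suc p) j)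
    nested⇒end-removable i<i _ (base _) = contradiction i<i (<-irrefl refl)
    nested⇒end-removable {i} {j} {e} {p} _ parts (step {k = k} {l} _ nkl ((i≤k , l≤j) , i<k⊎l<j) size) =
      split-at-ends
      where
      open EndParts parts
      ckl : Common P k l
      ckl = nested⇒common nkl
      split-at-ends : (Small b i e × RestNested P b i j i e) ⊎ (Small b (suc p) j × RestNested P b i j (suc p) j)
      split-at-ends with i <? k
      ... | yes i<k with l ≤? e
      ...   | yes l≤e = inj₂ (last-removable parts nkl i≤k (≤-trans l≤e e≤p) size)
      ...   | no  l≰e with k ≤? e
      ...     | yes k≤e = contradiction (inj₁ (i<k , k≤e , ≰⇒> l≰e)) (proj₂ first-strong k l ckl)
      ...     | no  k≰e = inj₁ (first-removable parts nkl (≰⇒> k≰e) l≤j size)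
      split-at-ends | no i≮k with l ≤? p
      ...   | yes l≤p = inj₂ (last-removable parts nkl i≤k l≤p size)
      ...   | no  l≰p = contradiction (inj₂ (k<1+p , ≰⇒> l≰p , l<j)) (proj₂ last-strong k l ckl)
        where
        k<1+p : k < suc p
        k<1+p = s≤s (≤-trans (≤-trans (≮⇒≥ i≮k) i≤e) e≤p)
        l<j : l < j
        l<j = [ (λ i<k → contradiction i<k i≮k) , id ]′ i<k⊎l<j

    end-removable⇒nested : ∀ {i j e p} → Common P i j → EndParts i j e p →
                           (Small b i e × RestNested P b i j i e) ⊎ (Small b (suc p) j × RestNested P b i j (suc p) j) →
                           Nested P b i j
    end-removable⇒nested cij parts =
      [ (λ (small , rest) → rest-nested⇒nested cij (≤-refl , ≤-trans e≤p (<⇒≤ p<j)) i≤e small rest) ,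
        (λ (small , rest) → rest-nested⇒nested cij (≤-trans i≤e (≤-trans e≤p (n≤1+n _)) , ≤-refl) p<j small rest) ]′
      where open EndParts parts

  q-interval-nontrivial : ∀ {i j} → QInterval P i j → i < j
  q-interval-nontrivial ((i≤j , j<n , _) , ¬P) = ≤∧≢⇒< i≤j (λ { refl → ¬P (P-interval-singleton P j<n) })

  domain-member : ∀ {i j k l} → Domain P i j k l → Strong P k l × Sub k l i j
  domain-member (inj₁ (_ , ch))                    = child-strong P ch , proj₁ (child-⊂ P ch)
  domain-member (inj₂ (_ , _ , _ , _ , ch , kl⊆ij , _)) = child-strong P ch , kl⊆ij

  record QDomain (i j : ℕ) (xs : List (ℕ × ℕ)) : Set where
    field
      a c        : ℕ
      qnode      : QNode P a c
      children   : All (IsChild a c) xs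
      i∈⋃        : InUnion xs i
      j∈⋃        : InUnion xs j
      not-single : ∀ x → xs ≢ [ x ]

  module _ {i j x₁ ys} (I-Q : QInterval P i j)
           (dom : ∀ x → x ∈ x₁ ∷ ys ⇔ Domain P i j (proj₁ x) (proj₂ x)) where

    private
      xs : List (ℕ × ℕ)
      xs = x₁ ∷ ys

      i≤j : i ≤ j
      i≤j = proj₁ (proj₁ I-Q)

      i<j : i < j
      i<j = q-interval-nontrivial I-Q

      ∈-single : ∀ {w x : ℕ × ℕ} → w ∈ [ x ] → w ≡ x
      ∈-single (here w≡x) = w≡x

      strong-domain : Strong P i j → DN (QDomain i j xs)
      strong-domain sij = do
        q ← λ ¬q → proj₂ I-Q (sij , ¬q)
        (k , l , chi , i∈kl) ← strong⇒covered-by-children P sij i<j (≤-refl , i≤j)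
        (k′ , l′ , chj , j∈kl′) ← strong⇒covered-by-children P sij i<j (i≤j , ≤-refl)
        pure record
          { qnode      = q
          ; children   = tabulate λ {w} w∈ → child-of (to (dom w) w∈)
          ; i∈⋃        = lose (from (dom (k , l)) (inj₁ (sij , chi))) i∈kl
          ; j∈⋃        = lose (from (dom (k′ , l′)) (inj₁ (sij , chj))) j∈kl′
          ; not-single = two-children q
          }
        where
        child-of : ∀ {k l} → Domain P i j k l → Child P i j k l
        child-of (inj₁ (_ , ch))    = ch
        child-of (inj₂ (¬sij , _)) = contradiction sij ¬sij
        two-children : QNode P i j → ∀ x → xs ≢ [ x ]
        two-children (_ , [] , _ , () , _)
        two-children (_ , _ ∷ [] , _ , s≤s () , _)
        two-children (_ , d₁ ∷ d₂ ∷ _ , ((d₁≢d₂ ∷ _) ∷ _) , _ , (ch₁ ∷ ch₂ ∷ _) , _) x xs≡[x] =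
          d₁≢d₂ (trans (member d₁ ch₁) (sym (member d₂ ch₂)))
          where
          member : ∀ d → Child P i j (proj₁ d) (proj₂ d) → d ≡ x
          member d ch = ∈-single (subst (d ∈_) xs≡[x] (from (dom d) (inj₁ (sij , ch))))

      -- When (i..j) is not strong, every member of the domain is a child of the Q-node given by x₁:
      -- a strong interval strictly between a child and the node would be squeezed onto (i..j).
      non-strong-domain : ¬ Strong P i j → QDomain i j xs
      non-strong-domain ¬sij with to (dom x₁) (here refl)
      ... | inj₁ (sij , _) = contradiction sij ¬sij
      ... | inj₂ (_ , a , c , q , _ , _ , cov) = record
        { qnode      = q
        ; children   = tabulate λ {w} w∈ → child-of (to (dom w) w∈)
        ; i∈⋃        = covering (≤-refl , i≤j)
        ; j∈⋃        = covering (i≤j , ≤-refl)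
        ; not-single = single-member
        }
        where
        Covers : ℕ → ℕ → Set
        Covers a′ c′ = ∀ e → InI i j e ⇔ (∃[ k ] ∃[ l ] (Child P a′ c′ k l × Sub k l i j × InI k l e))
        covering : ∀ {e} → InI i j e → InUnion xs e
        covering e∈ = let (k , l , ch , kl⊆ij , e∈kl) = to (cov _) e∈
                      in lose (from (dom (k , l)) (inj₂ (¬sij , a , c , q , ch , kl⊆ij , cov))) e∈kl
        ij⊆node : ∀ {a′ c′} → Covers a′ c′ → Sub i j a′ c′
        ij⊆node cov′ = let (_ , _ , chi , _ , i∈) = to (cov′ i) (≤-refl , i≤j)
                           (_ , _ , chj , _ , j∈) = to (cov′ j) (i≤j , ≤-refl)
                       in ≤-trans (proj₁ (proj₁ (child-⊂ P chi))) (proj₁ i∈) ,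
                          ≤-trans (proj₂ j∈) (proj₂ (proj₁ (child-⊂ P chj)))
        squeezed : ∀ {a′ c′ w₁ w₂} → Strong P a′ c′ → Sub w₁ w₂ i j → Sub i j a′ c′ → ¬ Sub a′ c′ w₁ w₂
        squeezed sac′ (i≤w₁ , w₂≤j) (a′≤i , j≤c′) (w₁≤a′ , c′≤w₂) =
          ¬sij (subst₂ (Strong P) (≤-antisym a′≤i (≤-trans i≤w₁ w₁≤a′)) (≤-antisym (≤-trans c′≤w₂ w₂≤j) j≤c′) sac′)
        child-of : ∀ {w₁ w₂} → Domain P i j w₁ w₂ → Child P a c w₁ w₂
        child-of (inj₁ (sij , _)) = contradiction sij ¬sij
        child-of {w₁} {w₂} (inj₂ (_ , a′ , c′ , q′ , chw , w⊆ij , cov′))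
          with to (cov w₁) (proj₁ w⊆ij , ≤-trans (child-≤ P chw) (proj₂ w⊆ij))
        ... | k , l , ch , kl⊆ij , w₁∈kl
          with strong-laminar P (child-strong P chw) (proj₁ (child-strong P ch)) (≤-refl , child-≤ P chw) w₁∈kl
        ...   | inj₁ kl⊆w = let (k≡w₁ , l≡w₂) = child-maximal P ch (child-strong P chw) kl⊆w
                                                  (squeezed (proj₁ q) w⊆ij (ij⊆node cov))
                            in subst₂ (Child P a c) k≡w₁ l≡w₂ ch
        ...   | inj₂ w⊆kl = let (w₁≡k , w₂≡l) = child-maximal P chw (child-strong P ch) w⊆kl
                                                  (squeezed (proj₁ q′) kl⊆ij (ij⊆node cov′))
                            in subst₂ (Child P a c) (sym w₁≡k) (sym w₂≡l) ch
        single-member : ∀ x → xs ≢ [ x ]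
        single-member x xs≡[x] = ¬sij (subst₂ (Strong P) start≡i end≡j sx₁)
          where
          is-x₁ : ∀ {w} → w ∈ xs → w ≡ x₁
          is-x₁ {w} w∈ = trans (∈-single (subst (w ∈_) xs≡[x] w∈)) (sym (∈-single (subst (x₁ ∈_) xs≡[x] (here refl))))
          in-x₁ : ∀ {e} → InI i j e → InI (proj₁ x₁) (proj₂ x₁) e
          in-x₁ e∈ = let (w , w∈ , e∈w) = find (covering e∈) in subst (λ z → InI (proj₁ z) (proj₂ z) _) (is-x₁ w∈) e∈w
          sx₁ : Strong P (proj₁ x₁) (proj₂ x₁)
          sx₁ = proj₁ (domain-member (to (dom x₁) (here refl)))
          x₁⊆ij : Sub (proj₁ x₁) (proj₂ x₁) i j
          x₁⊆ij = proj₂ (domain-member (to (dom x₁) (here refl)))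
          start≡i : proj₁ x₁ ≡ i
          start≡i = ≤-antisym (proj₁ (in-x₁ (≤-refl , i≤j))) (proj₁ x₁⊆ij)
          end≡j : proj₂ x₁ ≡ j
          end≡j = ≤-antisym (proj₂ x₁⊆ij) (proj₂ (in-x₁ (i≤j , ≤-refl)))

    q-interval-domain : DN (QDomain i j xs)
    q-interval-domain = ¬¬-excluded-middle >>= λ
      { (yes sij) → strong-domain sij
      ; (no ¬sij) → pure (non-strong-domain ¬sij) }

  q-interval-ends : ∀ {i j x₁ ys xᵣ zs} (I-Q : QInterval P i j) →
                    (∀ x → x ∈ x₁ ∷ ys ⇔ Domain P i j (proj₁ x) (proj₂ x)) →
                    Linked (λ x y → suc (proj₂ x) ≡ proj₁ y) (x₁ ∷ ys) → x₁ ∷ ys ≡ zs ++ [ xᵣ ] →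
                    ∃[ e ] ∃[ p ] (x₁ ≡ (i , e) × xᵣ ≡ (suc p , j) × EndParts i j e p)
  q-interval-ends {ys = []} I-Q dom _ _ = ⊥-elim (q-interval-domain I-Q dom (λ D → QDomain.not-single D _ refl))
  q-interval-ends {ys = _ ∷ _} {zs = []} _ _ _ eq = contradiction (∷-injectiveʳ eq) λ ()
  q-interval-ends {i} {j} {x₁} {y ∷ ys} {xᵣ} {z ∷ zs} I-Q dom linked eq =
    proj₂ x₁ , p , cong (_, proj₂ x₁) starts-at-i , cong₂ _,_ (sym 1+p≡) ends-at-j , record
      { first-strong = subst (λ s → Strong P s _) starts-at-i (proj₁ (member (here refl)))
      ; last-strong  = subst₂ (Strong P) (sym 1+p≡) ends-at-j (proj₁ (member (there xᵣ∈tail)))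
      ; e≤p          = s≤s⁻¹ (<-≤-trans (≤-reflexive (spans-link spans))
                                        (≤-trans (proj₁ (spans-⊆ (spans-tail spans) (All.tail ordered) xᵣ∈tail))
                                                 (≤-reflexive (sym 1+p≡))))
      ; after-first  = subst (Common P _) ends-at-j (decidable-stable (common? P _ _) (do
          D ← q-interval-domain I-Q dom
          subst (λ s → Common P s _) (sym (spans-link spans)) <$>
            spanned-children-common (QDomain.qnode D) (All.tail (QDomain.children D)) (spans-tail spans)))
      ; before-last  = subst (λ s → Common P s p) starts-at-i (decidable-stable (common? P _ _) (do
          D ← q-interval-domain I-Q dom
          subst (λ w → Common P (proj₁ w) p) (∷-injectiveˡ (sym eq)) <$>
            spanned-children-common (QDomain.qnode D) (++⁻ˡ (z ∷ zs) (subst (All _) eq (QDomain.children D))) init))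
      }
    where
    spans-snoc : Spans ((z ∷ zs) ++ [ xᵣ ]) (proj₂ xᵣ)
    spans-snoc = linked⇒spans (z ∷ zs) xᵣ (subst (Linked _) eq linked)
    spans : Spans (x₁ ∷ y ∷ ys) (proj₂ xᵣ)
    spans = subst (λ L → Spans L (proj₂ xᵣ)) (sym eq) spans-snoc
    last-before-xᵣ : ∃[ p ] (Spans (z ∷ zs) p × suc p ≡ proj₁ xᵣ)
    last-before-xᵣ = spans-init zs xᵣ spans-snoc
    p : ℕ
    p = proj₁ last-before-xᵣ
    init : Spans (z ∷ zs) p
    init = proj₁ (proj₂ last-before-xᵣ)
    1+p≡ : suc p ≡ proj₁ xᵣ
    1+p≡ = proj₂ (proj₂ last-before-xᵣ)
    member : ∀ {w} → w ∈ x₁ ∷ y ∷ ys → Strong P (proj₁ w) (proj₂ w) × Sub (proj₁ w) (proj₂ w) i j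
    member {w} w∈ = domain-member (to (dom w) w∈)
    ordered : All Ordered (x₁ ∷ y ∷ ys)
    ordered = tabulate (proj₁ ∘ proj₁ ∘ proj₁ ∘ member)
    xᵣ∈tail : xᵣ ∈ y ∷ ys
    xᵣ∈tail = subst (xᵣ ∈_) (sym (∷-injectiveʳ eq)) (∈-++⁺ʳ zs (here refl))
    starts-at-i : proj₁ x₁ ≡ i
    starts-at-i = decidable-stable (proj₁ x₁ ≟ i) (do
      D ← q-interval-domain I-Q dom
      let (w , w∈ , i∈w) = find (QDomain.i∈⋃ D)
      pure (≤-antisym (≤-trans (proj₁ (spans-⊆ spans ordered w∈)) (proj₁ i∈w)) (proj₁ (proj₂ (member (here refl))))))
    ends-at-j : proj₂ xᵣ ≡ j
    ends-at-j = decidable-stable (proj₂ xᵣ ≟ j) (do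
      D ← q-interval-domain I-Q dom
      let (w , w∈ , j∈w) = find (QDomain.j∈⋃ D)
      pure (≤-antisym (proj₂ (proj₂ (member (there xᵣ∈tail)))) (≤-trans (proj₂ j∈w) (proj₂ (spans-⊆ spans ordered w∈)))))

lemma3 : {n K : ℕ} (P : Fin (suc K) → Permutation′ n) → 1 ≤ n →
         ((p : Fin n) → P zero ⟨$⟩ʳ p ≡ p) →
         (b : ℕ) → 1 ≤ b →
         (i j : ℕ) → QInterval P i j →
         (xs : List (ℕ × ℕ)) → Unique xs →
         ((x : ℕ × ℕ) → (x ∈ xs ⇔ Domain P i j (proj₁ x) (proj₂ x))) →
         Linked (λ x y → suc (proj₂ x) ≡ proj₁ y) xs →
         (x₁ xᵣ : ℕ × ℕ) (ys zs : List (ℕ × ℕ)) →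
         xs ≡ x₁ ∷ ys → xs ≡ zs ++ [ xᵣ ] →
         (Nested P b i j ⇔
           ((Small b (proj₁ x₁) (proj₂ x₁) × RestNested P b i j (proj₁ x₁) (proj₂ x₁)) ⊎
            (Small b (proj₁ xᵣ) (proj₂ xᵣ) × RestNested P b i j (proj₁ xᵣ) (proj₂ xᵣ))))
lemma3 P _ _ b _ i j I-Q _ _ dom linked x₁ xᵣ ys zs refl xs≡zs∷ʳxᵣ
  with q-interval-ends P I-Q dom linked xs≡zs∷ʳxᵣ
... | e , p , refl , refl , parts =
  mk⇔ (nested⇒end-removable P b (q-interval-nontrivial P I-Q) parts)
      (end-removable⇒nested P b (proj₁ I-Q) parts)
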